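{- For every $n\ge 0$, the two polynomials in $b$ \[ \sum_{\lambda \vdash n} \prod_{\substack{h \in \mathcal{H}(\lambda)\\ h \in\{1,2\}}} \left(1-\frac{b}{h^2}\right) \quad \text{ and } \quad \sum_{\lambda \vdash n} (1-b)^{\ell_0(\lambda)} \prod_{j:\, \lambda_j \ge 2} \left(1-\frac{b}{2}\right) \] have the same constant term and the same coefficient of $b$.
   Context: For a partition $\lambda$ of $n$, $\mathcal{H}(\lambda)$ denotes the multiset of hook lengths of the cells of its Ferrers diagram (the hook length of a cell is the number of cells directly to its right in the same row plus the number directly below/above it in the same column (arm plus leg), plus one); the first product is over all cells whose hook length is $1$ or $2$. $\ell_0(\lambda)$ is the number of distinct part sizes in $\lambda$. Writing $\lambda$ in frequency notation $\lambda=1^{\lambda_1}2^{\lambda_2}3^{\lambda_3}\cdots$ ($\lambda_j$ = number of parts equal to $j$), the second product is over all $j$ with $\lambda_j\ge 2$. -}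

module Defs where

open import Data.Bool using (Bool; true; false; _∨_)
open import Data.Nat as ℕ using (ℕ; zero; suc; _∸_; _≤ᵇ_; _<ᵇ_; _≡ᵇ_)
open import Data.List using (List; []; _∷_; map; foldr; length; upTo; concatMap; filterᵇ; deduplicateᵇ; _++_)
open import Data.Integer using (+_)
open import Data.Rational as ℚ using (ℚ; 0ℚ; 1ℚ; _/_)

-- Polynomials in one variable b over ℚ, as coefficient lists
-- (lowest degree first).  Trailing zeros are allowed; 'coeff' extracts
-- the coefficient of b^k (0 beyond the list).

Poly : Set
Poly = List ℚ

infixl 6 _⊕_
infixl 7 _⊗_

_⊕_ : Poly → Poly → Poly
[] ⊕ q = q
(a ∷ p) ⊕ [] = a ∷ p
(a ∷ p) ⊕ (c ∷ q) = (a ℚ.+ c) ∷ (p ⊕ q)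

scale : ℚ → Poly → Poly
scale a = map (a ℚ.*_)

_⊗_ : Poly → Poly → Poly
[] ⊗ q = []
(a ∷ p) ⊗ q = scale a q ⊕ (0ℚ ∷ (p ⊗ q))

oneP : Poly
oneP = 1ℚ ∷ []

polySum : List Poly → Poly
polySum = foldr _⊕_ []

polyProd : List Poly → Poly
polyProd = foldr _⊗_ oneP

polyPow : Poly → ℕ → Poly
polyPow p zero = oneP
polyPow p (suc k) = p ⊗ polyPow p k

coeff : Poly → ℕ → ℚ
coeff [] _ = 0ℚ
coeff (a ∷ p) zero = a
coeff (a ∷ p) (suc k) = coeff p k

oneMinus : ℚ → Poly
oneMinus c = 1ℚ ∷ ℚ.- c ∷ []

-- Partitions: a partition is a weakly decreasing list of positive parts.
-- 'parts f n m' lists all partitions of n with all parts ≤ m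
-- (f is fuel, f ≥ n suffices since every part is ≥ 1).

parts : ℕ → ℕ → ℕ → List (List ℕ)
parts _ zero _ = [] ∷ []
parts zero (suc _) _ = []
parts (suc f) (suc n) m =
  concatMap (λ k → map (k ∷_) (parts f (suc n ∸ k) k))
            (filterᵇ (λ k → k ≤ᵇ m) (map suc (upTo (suc n))))

partitions : ℕ → List (List ℕ)
partitions n = parts n n n

-- Hook lengths.  For a partition given by its rows r₀ ≥ r₁ ≥ …, the cell
-- in row i, column j (0-indexed, j < rᵢ) has arm rᵢ - j - 1 and leg
-- #{k > i : r_k > j}; hook = arm + leg + 1.

hooks : List ℕ → List ℕ
hooks [] = []
hooks (r ∷ rs) =
  map (λ j → (r ∸ suc j) ℕ.+ length (filterᵇ (λ x → j <ᵇ x) rs) ℕ.+ 1) (upTo r)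
  ++ hooks rs

smallHooks : List ℕ → List ℕ
smallHooks λ' = filterᵇ (λ h → (h ≡ᵇ 1) ∨ (h ≡ᵇ 2)) (hooks λ')

-- 1 / h² (h = 0 never occurs as a hook length; value there is irrelevant)
invSq : ℕ → ℚ
invSq zero = 0ℚ
invSq (suc k) = (+ 1) / (suc k ℕ.* suc k)

-- number of parts equal to j  (λ_j in frequency notation)
mult : ℕ → List ℕ → ℕ
mult j λ' = length (filterᵇ (λ x → x ≡ᵇ j) λ')

distinctParts : List ℕ → List ℕ
distinctParts = deduplicateᵇ _≡ᵇ_

ℓ₀ : List ℕ → ℕ
ℓ₀ λ' = length (distinctParts λ')

repeatedSizes : List ℕ → ℕ
repeatedSizes λ' = length (filterᵇ (λ j → 2 ≤ᵇ mult j λ') (distinctParts λ'))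

hookPoly : ℕ → Poly
hookPoly n = polySum (map (λ λ' → polyProd (map (λ h → oneMinus (invSq h)) (smallHooks λ')))
                          (partitions n))

freqPoly : ℕ → Poly
freqPoly n = polySum (map (λ λ' → polyPow (oneMinus 1ℚ) (ℓ₀ λ')
                                   ⊗ polyProd (map (λ j → oneMinus ((+ 1) / 2))
                                                   (filterᵇ (λ j → 2 ≤ᵇ mult j λ') (distinctParts λ'))))
                          (partitions n))

-- Every summand on either side is a product of factors 1 - c·b, so it has constant term 1 and
-- linear coefficient -Σ c.  Both constant terms therefore count the partitions of n, and the claim
-- for the linear terms reduces to
--   Σ_λ #{h = 1} + ¼ Σ_λ #{h = 2}  =  Σ_λ ℓ₀(λ) + ½ Σ_λ #{j : λ_j ≥ 2}.
-- This follows from three facts about a partition λ with rows r₀ ≥ r₁ ≥ ⋯: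
--   * the cells of hook length 1 are the ends of rows with rᵢ > rᵢ₊₁, one per distinct part size;
--   * the cells of hook length 2 are the "horizontal" ones (rᵢ ≥ rᵢ₊₁ + 2) and the "vertical"
--     ones (rᵢ = rᵢ₊₁ ≠ rᵢ₊₂), and the vertical ones correspond to the repeated part sizes;
--   * conjugation exchanges horizontal and vertical 2-hooks and permutes the partitions of n,
--     so in total there are as many horizontal as vertical 2-hooks.
module Submission where

open import Defs
open import Data.Nat using (ℕ)
open import Data.Product using (_×_)
open import Relation.Binary.PropositionalEquality using (_≡_)

open import Function using (_∘_; const)
open import Function.Bundles using (mk⇔)
open import Data.Bool using (Bool; true; false; T; T?; not; _∧_; _∨_)
open import Data.Empty using (⊥; ⊥-elim)
open import Data.Sum using (inj₁; inj₂)
open import Data.Product using (_,_; proj₁)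
open import Relation.Nullary using (¬_; ¬?; yes; no)
open import Data.Nat using (zero; suc; _+_; _∸_; _≤_; _<_; z≤n; s≤s; _≤ᵇ_; _<ᵇ_; _≡ᵇ_; _≤?_)
open import Data.Nat.Properties
open import Data.Nat.ListAction using (sum)
open import Data.Nat.ListAction.Properties using (sum-↭)
open import Data.List using (List; []; _∷_; _++_; map; foldr; length; replicate; upTo; drop; concatMap; filter; filterᵇ)
open import Data.List.Properties
  using (map-∘; map-id; map-++; map-cong-local; ∷-injective; ∷-injectiveʳ; length-++; upTo-∷ʳ;
         filter-++; filter-accept; filter-reject; filter-none; filter-all; filter-idem)
open import Data.List.Relation.Unary.All as All using (All; []; _∷_)
import Data.List.Relation.Unary.All.Properties as AllP
open import Data.List.Relation.Unary.Any using (here)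
open import Data.List.Membership.Propositional using (_∈_; find; lose)
open import Data.List.Membership.Propositional.Properties
  using (∈-map⁺; ∈-map⁻; ∈-filter⁺; ∈-filter⁻; ∈-upTo⁺; ∈-upTo⁻; ∈-concatMap⁺; ∈-concatMap⁻)
open import Data.List.Membership.Propositional.Properties.WithK using (unique∧set⇒bag)
open import Data.List.Relation.Binary.BagAndSetEquality using (∼bag⇒↭)
open import Data.List.Relation.Binary.Permutation.Propositional using (_↭_)
import Data.List.Relation.Binary.Permutation.Propositional.Properties as ↭
open import Data.List.Relation.Unary.Unique.Propositional using (Unique)
import Data.List.Relation.Unary.Unique.Propositional.Properties as Unique
open import Data.List.Relation.Unary.AllPairs using ([]; _∷_)
open import Data.Rational as ℚ using (ℚ; 0ℚ; 1ℚ; ½)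
import Data.Rational.Properties as ℚP
open import Algebra.Bundles using (CommutativeMonoid)
open import Algebra.Properties.CommutativeMonoid.Mult ℚP.+-0-commutativeMonoid
  using (×-homo-+; ×-distrib-+) renaming (_×_ to _·_)
open import Algebra.Properties.CommutativeSemigroup
  (CommutativeMonoid.commutativeSemigroup ℚP.+-0-commutativeMonoid) using (interchange)
open import Algebra.Properties.CommutativeSemigroup +-commutativeSemigroup
  using (x∙yz≈y∙xz) renaming (interchange to ℕ-interchange)
open import Relation.Binary.PropositionalEquality using (refl; sym; trans; cong; cong₂; subst; module ≡-Reasoning)
open ≡-Reasoning

sumℚ : List ℚ → ℚ
sumℚ = foldr ℚ._+_ 0ℚ

coeff-⊕ : ∀ p q k → coeff (p ⊕ q) k ≡ coeff p k ℚ.+ coeff q k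
coeff-⊕ []      q       k       = sym (ℚP.+-identityˡ (coeff q k))
coeff-⊕ (a ∷ p) []      zero    = sym (ℚP.+-identityʳ a)
coeff-⊕ (a ∷ p) []      (suc k) = sym (ℚP.+-identityʳ (coeff p k))
coeff-⊕ (a ∷ p) (c ∷ q) zero    = refl
coeff-⊕ (a ∷ p) (c ∷ q) (suc k) = coeff-⊕ p q k

coeff-scale : ∀ a q k → coeff (scale a q) k ≡ a ℚ.* coeff q k
coeff-scale a []      k       = sym (ℚP.*-zeroʳ a)
coeff-scale a (x ∷ q) zero    = refl
coeff-scale a (x ∷ q) (suc k) = coeff-scale a q k

coeff₀-⊗ : ∀ p q → coeff (p ⊗ q) 0 ≡ coeff p 0 ℚ.* coeff q 0
coeff₀-⊗ []      q = sym (ℚP.*-zeroˡ (coeff q 0))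
coeff₀-⊗ (a ∷ p) q = begin
  coeff (scale a q ⊕ (0ℚ ∷ (p ⊗ q))) 0 ≡⟨ coeff-⊕ (scale a q) (0ℚ ∷ (p ⊗ q)) 0 ⟩
  coeff (scale a q) 0 ℚ.+ 0ℚ           ≡⟨ ℚP.+-identityʳ (coeff (scale a q) 0) ⟩
  coeff (scale a q) 0                  ≡⟨ coeff-scale a q 0 ⟩
  a ℚ.* coeff q 0                      ∎

coeff₁-⊗ : ∀ p q → coeff (p ⊗ q) 1 ≡ coeff p 0 ℚ.* coeff q 1 ℚ.+ coeff p 1 ℚ.* coeff q 0
coeff₁-⊗ []      q = sym (cong₂ ℚ._+_ (ℚP.*-zeroˡ (coeff q 1)) (ℚP.*-zeroˡ (coeff q 0)))
coeff₁-⊗ (a ∷ p) q = begin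
  coeff (scale a q ⊕ (0ℚ ∷ (p ⊗ q))) 1    ≡⟨ coeff-⊕ (scale a q) (0ℚ ∷ (p ⊗ q)) 1 ⟩
  coeff (scale a q) 1 ℚ.+ coeff (p ⊗ q) 0 ≡⟨ cong₂ ℚ._+_ (coeff-scale a q 1) (coeff₀-⊗ p q) ⟩
  a ℚ.* coeff q 1 ℚ.+ coeff p 0 ℚ.* coeff q 0 ∎

coeff₀-⊗-unit : ∀ p q → coeff p 0 ≡ 1ℚ → coeff q 0 ≡ 1ℚ → coeff (p ⊗ q) 0 ≡ 1ℚ
coeff₀-⊗-unit p q p₀ q₀ = begin
  coeff (p ⊗ q) 0         ≡⟨ coeff₀-⊗ p q ⟩
  coeff p 0 ℚ.* coeff q 0 ≡⟨ cong₂ ℚ._*_ p₀ q₀ ⟩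
  1ℚ                      ∎

coeff₁-⊗-unit : ∀ p q → coeff p 0 ≡ 1ℚ → coeff q 0 ≡ 1ℚ → coeff (p ⊗ q) 1 ≡ coeff p 1 ℚ.+ coeff q 1
coeff₁-⊗-unit p q p₀ q₀ = begin
  coeff (p ⊗ q) 1                                   ≡⟨ coeff₁-⊗ p q ⟩
  coeff p 0 ℚ.* coeff q 1 ℚ.+ coeff p 1 ℚ.* coeff q 0 ≡⟨ cong₂ (λ u v → u ℚ.* coeff q 1 ℚ.+ coeff p 1 ℚ.* v) p₀ q₀ ⟩
  1ℚ ℚ.* coeff q 1 ℚ.+ coeff p 1 ℚ.* 1ℚ              ≡⟨ cong₂ ℚ._+_ (ℚP.*-identityˡ (coeff q 1)) (ℚP.*-identityʳ (coeff p 1)) ⟩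
  coeff q 1 ℚ.+ coeff p 1                           ≡⟨ ℚP.+-comm (coeff q 1) (coeff p 1) ⟩
  coeff p 1 ℚ.+ coeff q 1                           ∎

linearProduct-coeff₀ : ∀ cs → coeff (polyProd (map oneMinus cs)) 0 ≡ 1ℚ
linearProduct-coeff₀ []       = refl
linearProduct-coeff₀ (c ∷ cs) =
  coeff₀-⊗-unit (oneMinus c) (polyProd (map oneMinus cs)) refl (linearProduct-coeff₀ cs)

linearProduct-coeff₁ : ∀ cs → coeff (polyProd (map oneMinus cs)) 1 ≡ ℚ.- sumℚ cs
linearProduct-coeff₁ []       = refl
linearProduct-coeff₁ (c ∷ cs) = begin
  coeff (oneMinus c ⊗ P) 1    ≡⟨ coeff₁-⊗-unit (oneMinus c) P refl (linearProduct-coeff₀ cs) ⟩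
  ℚ.- c ℚ.+ coeff P 1         ≡⟨ cong (ℚ.- c ℚ.+_) (linearProduct-coeff₁ cs) ⟩
  ℚ.- c ℚ.+ ℚ.- sumℚ cs       ≡⟨ sym (ℚP.neg-distrib-+ c (sumℚ cs)) ⟩
  ℚ.- (c ℚ.+ sumℚ cs)         ∎
  where P = polyProd (map oneMinus cs)

polyPow-linear : ∀ c k → polyPow (oneMinus c) k ≡ polyProd (map oneMinus (replicate k c))
polyPow-linear c zero    = refl
polyPow-linear c (suc k) = cong (oneMinus c ⊗_) (polyPow-linear c k)

sumℚ-replicate : ∀ k c → sumℚ (replicate k c) ≡ k · c
sumℚ-replicate zero    c = refl
sumℚ-replicate (suc k) c = cong (c ℚ.+_) (sumℚ-replicate k c)

power-coeff₀ : ∀ c k → coeff (polyPow (oneMinus c) k) 0 ≡ 1ℚ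
power-coeff₀ c k = trans (cong (λ P → coeff P 0) (polyPow-linear c k)) (linearProduct-coeff₀ (replicate k c))

power-coeff₁ : ∀ c k → coeff (polyPow (oneMinus c) k) 1 ≡ ℚ.- (k · c)
power-coeff₁ c k = begin
  coeff (polyPow (oneMinus c) k) 1                  ≡⟨ cong (λ P → coeff P 1) (polyPow-linear c k) ⟩
  coeff (polyProd (map oneMinus (replicate k c))) 1 ≡⟨ linearProduct-coeff₁ (replicate k c) ⟩
  ℚ.- sumℚ (replicate k c)                          ≡⟨ cong ℚ.-_ (sumℚ-replicate k c) ⟩
  ℚ.- (k · c)                                       ∎

constProduct : ∀ {A : Set} (p : Poly) (xs : List A) → polyProd (map (const p) xs) ≡ polyPow p (length xs)
constProduct p []       = refl
constProduct p (x ∷ xs) = cong (p ⊗_) (constProduct p xs)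

¼ : ℚ
¼ = invSq 2

sumInvSq-small : ∀ hs →
  sumℚ (map invSq (filterᵇ (λ h → (h ≡ᵇ 1) ∨ (h ≡ᵇ 2)) hs)) ≡ mult 1 hs · 1ℚ ℚ.+ mult 2 hs · ¼
sumInvSq-small []                      = refl
sumInvSq-small (zero ∷ hs)             = sumInvSq-small hs
sumInvSq-small (suc zero ∷ hs)         = trans (cong (1ℚ ℚ.+_) (sumInvSq-small hs))
                                               (sym (ℚP.+-assoc 1ℚ (mult 1 hs · 1ℚ) (mult 2 hs · ¼)))
sumInvSq-small (suc (suc zero) ∷ hs)   = begin
  ¼ ℚ.+ sumℚ (map invSq (filterᵇ _ hs)) ≡⟨ cong (¼ ℚ.+_) (sumInvSq-small hs) ⟩
  ¼ ℚ.+ (A ℚ.+ B)                       ≡⟨ sym (ℚP.+-assoc ¼ A B) ⟩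
  (¼ ℚ.+ A) ℚ.+ B                       ≡⟨ cong (ℚ._+ B) (ℚP.+-comm ¼ A) ⟩
  (A ℚ.+ ¼) ℚ.+ B                       ≡⟨ ℚP.+-assoc A ¼ B ⟩
  A ℚ.+ (¼ ℚ.+ B)                       ∎
  where A = mult 1 hs · 1ℚ
        B = mult 2 hs · ¼
sumInvSq-small (suc (suc (suc _)) ∷ hs) = sumInvSq-small hs

repeatedParts : List ℕ → List ℕ
repeatedParts λ' = filterᵇ (λ j → 2 ≤ᵇ mult j λ') (distinctParts λ')

hookTerm : List ℕ → Poly
hookTerm λ' = polyProd (map (λ h → oneMinus (invSq h)) (smallHooks λ'))

freqTerm : List ℕ → Poly
freqTerm λ' = polyPow (oneMinus 1ℚ) (ℓ₀ λ') ⊗ polyProd (map (λ j → oneMinus ½) (repeatedParts λ'))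

freqTerm-powers : ∀ λ' → freqTerm λ' ≡ polyPow (oneMinus 1ℚ) (ℓ₀ λ') ⊗ polyPow (oneMinus ½) (repeatedSizes λ')
freqTerm-powers λ' = cong (polyPow (oneMinus 1ℚ) (ℓ₀ λ') ⊗_) (constProduct (oneMinus ½) (repeatedParts λ'))

hookTerm-coeff₀ : ∀ λ' → coeff (hookTerm λ') 0 ≡ 1ℚ
hookTerm-coeff₀ λ' = trans (cong (λ P → coeff (polyProd P) 0) (map-∘ (smallHooks λ')))
                           (linearProduct-coeff₀ (map invSq (smallHooks λ')))

freqTerm-coeff₀ : ∀ λ' → coeff (freqTerm λ') 0 ≡ 1ℚ
freqTerm-coeff₀ λ' = trans (cong (λ P → coeff P 0) (freqTerm-powers λ'))
  (coeff₀-⊗-unit (polyPow (oneMinus 1ℚ) (ℓ₀ λ')) (polyPow (oneMinus ½) (repeatedSizes λ'))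
                 (power-coeff₀ 1ℚ (ℓ₀ λ')) (power-coeff₀ ½ (repeatedSizes λ')))

hookTerm-coeff₁ : ∀ λ' → coeff (hookTerm λ') 1 ≡ ℚ.- (mult 1 (hooks λ') · 1ℚ ℚ.+ mult 2 (hooks λ') · ¼)
hookTerm-coeff₁ λ' = begin
  coeff (hookTerm λ') 1                                         ≡⟨ cong (λ P → coeff (polyProd P) 1) (map-∘ (smallHooks λ')) ⟩
  coeff (polyProd (map oneMinus (map invSq (smallHooks λ')))) 1 ≡⟨ linearProduct-coeff₁ (map invSq (smallHooks λ')) ⟩
  ℚ.- sumℚ (map invSq (smallHooks λ'))                          ≡⟨ cong ℚ.-_ (sumInvSq-small (hooks λ')) ⟩
  ℚ.- (mult 1 (hooks λ') · 1ℚ ℚ.+ mult 2 (hooks λ') · ¼)        ∎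

freqTerm-coeff₁ : ∀ λ' → coeff (freqTerm λ') 1 ≡ ℚ.- (ℓ₀ λ' · 1ℚ ℚ.+ repeatedSizes λ' · ½)
freqTerm-coeff₁ λ' = begin
  coeff (freqTerm λ') 1                           ≡⟨ cong (λ P → coeff P 1) (freqTerm-powers λ') ⟩
  coeff (P ⊗ Q) 1                                 ≡⟨ coeff₁-⊗-unit P Q (power-coeff₀ 1ℚ (ℓ₀ λ')) (power-coeff₀ ½ (repeatedSizes λ')) ⟩
  coeff P 1 ℚ.+ coeff Q 1                         ≡⟨ cong₂ ℚ._+_ (power-coeff₁ 1ℚ (ℓ₀ λ')) (power-coeff₁ ½ (repeatedSizes λ')) ⟩
  ℚ.- (ℓ₀ λ' · 1ℚ) ℚ.+ ℚ.- (repeatedSizes λ' · ½) ≡⟨ sym (ℚP.neg-distrib-+ (ℓ₀ λ' · 1ℚ) (repeatedSizes λ' · ½)) ⟩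
  ℚ.- (ℓ₀ λ' · 1ℚ ℚ.+ repeatedSizes λ' · ½)       ∎
  where
  P = polyPow (oneMinus 1ℚ) (ℓ₀ λ')
  Q = polyPow (oneMinus ½) (repeatedSizes λ')

polySum-coeff₀ : ∀ {A : Set} (G : A → Poly) → (∀ x → coeff (G x) 0 ≡ 1ℚ) →
  ∀ xs → coeff (polySum (map G xs)) 0 ≡ length xs · 1ℚ
polySum-coeff₀ G G₀ []       = refl
polySum-coeff₀ G G₀ (x ∷ xs) =
  trans (coeff-⊕ (G x) (polySum (map G xs)) 0) (cong₂ ℚ._+_ (G₀ x) (polySum-coeff₀ G G₀ xs))

polySum-coeff₁ : ∀ {A : Set} (G : A → Poly) (a b : A → ℕ) (u v : ℚ) →
  (∀ x → coeff (G x) 1 ≡ ℚ.- (a x · u ℚ.+ b x · v)) →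
  ∀ xs → coeff (polySum (map G xs)) 1 ≡ ℚ.- (sum (map a xs) · u ℚ.+ sum (map b xs) · v)
polySum-coeff₁ G a b u v G₁ []       = refl
polySum-coeff₁ G a b u v G₁ (x ∷ xs) = begin
  coeff (G x ⊕ polySum (map G xs)) 1           ≡⟨ coeff-⊕ (G x) (polySum (map G xs)) 1 ⟩
  coeff (G x) 1 ℚ.+ coeff (polySum (map G xs)) 1 ≡⟨ cong₂ ℚ._+_ (G₁ x) (polySum-coeff₁ G a b u v G₁ xs) ⟩
  ℚ.- (a x · u ℚ.+ b x · v) ℚ.+ ℚ.- (A · u ℚ.+ B · v) ≡⟨ sym (ℚP.neg-distrib-+ (a x · u ℚ.+ b x · v) (A · u ℚ.+ B · v)) ⟩
  ℚ.- ((a x · u ℚ.+ b x · v) ℚ.+ (A · u ℚ.+ B · v)) ≡⟨ cong ℚ.-_ (interchange (a x · u) (b x · v) (A · u) (B · v)) ⟩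
  ℚ.- ((a x · u ℚ.+ A · u) ℚ.+ (b x · v ℚ.+ B · v)) ≡⟨ cong ℚ.-_ (sym (cong₂ ℚ._+_ (×-homo-+ u (a x) A) (×-homo-+ v (b x) B))) ⟩
  ℚ.- ((a x + A) · u ℚ.+ (b x + B) · v)       ∎
  where A = sum (map a xs)
        B = sum (map b xs)

double-quarter : ∀ m → (m + m) · ¼ ≡ m · ½
double-quarter m = trans (×-homo-+ ¼ m m) (sym (×-distrib-+ ¼ ¼ m))

head₀ : List ℕ → ℕ
head₀ []      = 0
head₀ (x ∷ _) = x

data IsPartition : List ℕ → Set where
  []   : IsPartition []
  cons : ∀ {r rs} → 1 ≤ r → head₀ rs ≤ r → IsPartition rs → IsPartition (r ∷ rs)

parts≤head : ∀ {xs} → IsPartition xs → All (_≤ head₀ xs) xs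
parts≤head []               = []
parts≤head (cons _ rs≤r ps) = ≤-refl ∷ All.map (λ x≤ → ≤-trans x≤ rs≤r) (parts≤head ps)

head≤sum : ∀ xs → head₀ xs ≤ sum xs
head≤sum []       = z≤n
head≤sum (x ∷ xs) = m≤m+n x (sum xs)

firstParts : ℕ → ℕ → List ℕ
firstParts n m = filterᵇ (λ k → k ≤ᵇ m) (map suc (upTo (suc n)))

firstParts⁻ : ∀ {n m k} → k ∈ firstParts n m → 1 ≤ k × k ≤ suc n × k ≤ m
firstParts⁻ {n} {m} k∈ with ∈-filter⁻ (λ k → T? (k ≤ᵇ m)) {xs = map suc (upTo (suc n))} k∈
... | k∈suc , k≤m with ∈-map⁻ suc k∈suc
... | j , j∈ , refl = s≤s z≤n , ∈-upTo⁻ j∈ , ≤ᵇ⇒≤ (suc j) m k≤m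

firstParts⁺ : ∀ {n m k} → 1 ≤ k → k ≤ suc n → k ≤ m → k ∈ firstParts n m
firstParts⁺ {n} {m} {suc j} _ j<suc-n k≤m =
  ∈-filter⁺ (λ k → T? (k ≤ᵇ m)) (∈-map⁺ suc (∈-upTo⁺ j<suc-n)) (≤⇒≤ᵇ k≤m)

firstParts-unique : ∀ n m → Unique (firstParts n m)
firstParts-unique n m =
  Unique.filter⁺ (λ k → T? (k ≤ᵇ m)) (Unique.map⁺ suc-injective (Unique.upTo⁺ (suc n)))

parts-sound : ∀ f n m {xs} → xs ∈ parts f n m → IsPartition xs × sum xs ≡ n × head₀ xs ≤ m
parts-sound f       zero    m (here refl) = [] , refl , z≤n
parts-sound (suc f) (suc n) m xs∈
  with k , k∈ , kxs∈ ← find (∈-concatMap⁻ (λ k → map (k ∷_) (parts f (suc n ∸ k) k)) {xs = firstParts n m} xs∈)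
  with μ , μ∈ , refl ← ∈-map⁻ (k ∷_) kxs∈
  with 1≤k , k≤n , k≤m ← firstParts⁻ {n} {m} k∈
  with isP , sumμ , μ≤k ← parts-sound f (suc n ∸ k) k μ∈
  = cons 1≤k μ≤k isP , trans (cong (k +_) sumμ) (m+[n∸m]≡n k≤n) , k≤m

parts-complete : ∀ f n m {xs} → IsPartition xs → sum xs ≡ n → head₀ xs ≤ m → n ≤ f → xs ∈ parts f n m
parts-complete f       zero    m {[]}    _ _ _ _ = here refl
parts-complete f       zero    m {x ∷ xs} (cons 1≤x _ _) sum≡0 _ _ =
  ⊥-elim (1+n≰n (≤-trans (≤-trans 1≤x (m≤m+n x (sum xs))) (≤-reflexive sum≡0)))
parts-complete (suc f) (suc n) m {k ∷ μ} (cons 1≤k μ≤k isP) sum≡ k≤m (s≤s n≤f) =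
  ∈-concatMap⁺ (λ k → map (k ∷_) (parts f (suc n ∸ k) k)) {xs = firstParts n m}
    (lose (firstParts⁺ {n} {m} 1≤k k≤n k≤m) (∈-map⁺ (k ∷_) (parts-complete f (suc n ∸ k) k isP sumμ μ≤k rest≤f)))
  where
  k≤n : k ≤ suc n
  k≤n = ≤-trans (m≤m+n k (sum μ)) (≤-reflexive sum≡)
  sumμ : sum μ ≡ suc n ∸ k
  sumμ = trans (sym (m+n∸m≡n k (sum μ))) (cong (_∸ k) sum≡)
  rest≤f : suc n ∸ k ≤ f
  rest≤f = ≤-trans (∸-monoʳ-≤ (suc n) 1≤k) n≤f

unique-prefixed : ∀ (G : ℕ → List (List ℕ)) ks → Unique ks → (∀ k → Unique (G k)) →
  Unique (concatMap (λ k → map (k ∷_) (G k)) ks)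
unique-prefixed G []       _            _     = []
unique-prefixed G (k ∷ ks) (k∉ks ∷ uks) uG =
  Unique.++⁺ (Unique.map⁺ ∷-injectiveʳ (uG k)) (unique-prefixed G ks uks uG) disjoint
  where
  disjoint : ∀ {v} → v ∈ map (k ∷_) (G k) × v ∈ concatMap (λ k → map (k ∷_) (G k)) ks → ⊥
  disjoint (v∈₁ , v∈₂)
    with _ , _ , refl ← ∈-map⁻ (k ∷_) v∈₁
    with k′ , k′∈ , v∈k′ ← find (∈-concatMap⁻ (λ k → map (k ∷_) (G k)) {xs = ks} v∈₂)
    with _ , _ , eq ← ∈-map⁻ (k′ ∷_) v∈k′
    = All.lookup k∉ks k′∈ (proj₁ (∷-injective eq))

parts-unique : ∀ f n m → Unique (parts f n m)
parts-unique f       zero    m = [] ∷ []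
parts-unique zero    (suc n) m = []
parts-unique (suc f) (suc n) m = unique-prefixed (λ k → parts f (suc n ∸ k) k) (firstParts n m)
  (firstParts-unique n m) (λ k → parts-unique f (suc n ∸ k) k)

partitions-sound : ∀ n {xs} → xs ∈ partitions n → IsPartition xs × sum xs ≡ n
partitions-sound n xs∈ with isP , sum≡ , _ ← parts-sound n n n xs∈ = isP , sum≡

partitions-complete : ∀ n {xs} → IsPartition xs → sum xs ≡ n → xs ∈ partitions n
partitions-complete n {xs} isP sum≡ = parts-complete n n n isP sum≡ (subst (head₀ xs ≤_) sum≡ (head≤sum xs)) ≤-refl

-- Conjugation.  'addColumn r xs' adds a column of height r on the left of the diagram xs
-- (one cell to each of the first r rows, creating new rows of length 1 if needed);
-- the conjugate of r ∷ rs is the conjugate of rs with a column of height r added.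
addColumn : ℕ → List ℕ → List ℕ
addColumn zero    xs       = xs
addColumn (suc r) []       = 1 ∷ addColumn r []
addColumn (suc r) (x ∷ xs) = suc x ∷ addColumn r xs

conj : List ℕ → List ℕ
conj []       = []
conj (r ∷ rs) = addColumn r (conj rs)

addColumn-length : ∀ r xs → length xs ≤ r → length (addColumn r xs) ≡ r
addColumn-length zero    []       _         = refl
addColumn-length (suc r) []       _         = cong suc (addColumn-length r [] z≤n)
addColumn-length (suc r) (x ∷ xs) (s≤s len) = cong suc (addColumn-length r xs len)

addColumn-sum : ∀ r xs → length xs ≤ r → sum (addColumn r xs) ≡ r + sum xs
addColumn-sum zero    []       _         = refl
addColumn-sum (suc r) []       _         = cong suc (addColumn-sum r [] z≤n)
addColumn-sum (suc r) (x ∷ xs) (s≤s len) = cong suc (begin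
  x + sum (addColumn r xs) ≡⟨ cong (x +_) (addColumn-sum r xs len) ⟩
  x + (r + sum xs)         ≡⟨ sym (+-assoc x r (sum xs)) ⟩
  x + r + sum xs           ≡⟨ cong (_+ sum xs) (+-comm x r) ⟩
  r + x + sum xs           ≡⟨ +-assoc r x (sum xs) ⟩
  r + (x + sum xs)         ∎)

addColumn-head : ∀ r xs → head₀ (addColumn r xs) ≤ suc (head₀ xs)
addColumn-head zero    []       = z≤n
addColumn-head zero    (x ∷ xs) = n≤1+n x
addColumn-head (suc r) []       = ≤-refl
addColumn-head (suc r) (x ∷ xs) = ≤-refl

addColumn-partition : ∀ r {xs} → IsPartition xs → length xs ≤ r → IsPartition (addColumn r xs)
addColumn-partition zero    []               _         = []
addColumn-partition (suc r) []               _         = cons ≤-refl (addColumn-head r []) (addColumn-partition r [] z≤n)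
addColumn-partition (suc r) {x ∷ xs} (cons _ xs≤x isP) (s≤s len) =
  cons (s≤s z≤n) (≤-trans (addColumn-head r xs) (s≤s xs≤x)) (addColumn-partition r isP len)

conj-length : ∀ {xs} → IsPartition xs → length (conj xs) ≡ head₀ xs
conj-fits   : ∀ {r rs} → IsPartition rs → head₀ rs ≤ r → length (conj rs) ≤ r

conj-length []                        = refl
conj-length {r ∷ rs} (cons _ rs≤r isP) = addColumn-length r (conj rs) (conj-fits isP rs≤r)

conj-fits {r} isP rs≤r = subst (_≤ r) (sym (conj-length isP)) rs≤r

conj-partition : ∀ {xs} → IsPartition xs → IsPartition (conj xs)
conj-partition []                        = []
conj-partition {r ∷ rs} (cons _ rs≤r isP) = addColumn-partition r (conj-partition isP) (conj-fits isP rs≤r)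

conj-sum : ∀ {xs} → IsPartition xs → sum (conj xs) ≡ sum xs
conj-sum []                        = refl
conj-sum {r ∷ rs} (cons _ rs≤r isP) =
  trans (addColumn-sum r (conj rs) (conj-fits isP rs≤r)) (cong (r +_) (conj-sum isP))

conj-addColumn : ∀ r xs → 1 ≤ r → length xs ≤ r → conj (addColumn r xs) ≡ r ∷ conj xs
conj-addColumn (suc zero)    []           _ _           = refl
conj-addColumn (suc (suc r)) []           _ _           =
  cong (addColumn 1) (conj-addColumn (suc r) [] (s≤s z≤n) z≤n)
conj-addColumn (suc zero)    (x ∷ [])     _ _           = refl
conj-addColumn (suc zero)    (x ∷ _ ∷ _)  _ (s≤s ())
conj-addColumn (suc (suc r)) (x ∷ xs)     _ (s≤s len)   =
  cong (addColumn (suc x)) (conj-addColumn (suc r) xs (s≤s z≤n) len)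

conj-involutive : ∀ {xs} → IsPartition xs → conj (conj xs) ≡ xs
conj-involutive []                          = refl
conj-involutive {r ∷ rs} (cons 1≤r rs≤r isP) =
  trans (conj-addColumn r (conj rs) 1≤r (conj-fits isP rs≤r)) (cong (r ∷_) (conj-involutive isP))

conj-permutes : ∀ n → partitions n ↭ map conj (partitions n)
conj-permutes n = ∼bag⇒↭ (unique∧set⇒bag (parts-unique n n n) unique-conj (mk⇔ to from))
  where
  L = partitions n
  conj-partition-of-n : ∀ {xs} → xs ∈ L → conj xs ∈ L
  conj-partition-of-n xs∈ with isP , sum≡ ← partitions-sound n xs∈ =
    partitions-complete n (conj-partition isP) (trans (conj-sum isP) sum≡)
  conj²≡id : map conj (map conj L) ≡ L
  conj²≡id = trans (sym (map-∘ L))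
    (trans (map-cong-local (All.tabulate (conj-involutive ∘ proj₁ ∘ partitions-sound n))) (map-id L))
  unique-conj : Unique (map conj L)
  unique-conj = Unique.map⁻ (subst Unique (sym conj²≡id) (parts-unique n n n))
  to : ∀ {xs} → xs ∈ L → xs ∈ map conj L
  to xs∈ = subst (_∈ map conj L) (conj-involutive (proj₁ (partitions-sound n xs∈)))
                 (∈-map⁺ conj (conj-partition-of-n xs∈))
  from : ∀ {xs} → xs ∈ map conj L → xs ∈ L
  from xs∈ with _ , ys∈ , refl ← ∈-map⁻ conj xs∈ = conj-partition-of-n ys∈

sum-conj-invariant : ∀ (f : List ℕ → ℕ) n → sum (map (f ∘ conj) (partitions n)) ≡ sum (map f (partitions n))
sum-conj-invariant f n = begin
  sum (map (f ∘ conj) (partitions n))      ≡⟨ cong sum (map-∘ (partitions n)) ⟩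
  sum (map f (map conj (partitions n)))    ≡⟨ sym (sum-↭ (↭.map⁺ f (conj-permutes n))) ⟩
  sum (map f (partitions n))               ∎

𝟙 : Bool → ℕ
𝟙 true  = 1
𝟙 false = 0

≡ᵇ-refl : ∀ n → (n ≡ᵇ n) ≡ true
≡ᵇ-refl zero    = refl
≡ᵇ-refl (suc n) = ≡ᵇ-refl n

<⇒≡ᵇ-false : ∀ {m n} → m < n → (n ≡ᵇ m) ≡ false
<⇒≡ᵇ-false {zero}  {suc n} _         = refl
<⇒≡ᵇ-false {suc m} {suc n} (s≤s m<n) = <⇒≡ᵇ-false m<n

<⇒<ᵇ-true : ∀ {m n} → m < n → (m <ᵇ n) ≡ true
<⇒<ᵇ-true {zero}  {suc n} _         = refl
<⇒<ᵇ-true {suc m} {suc n} (s≤s m<n) = <⇒<ᵇ-true m<n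

≤⇒<ᵇ-false : ∀ {m n} → n ≤ m → (m <ᵇ n) ≡ false
≤⇒<ᵇ-false {m}     {zero}  _         = refl
≤⇒<ᵇ-false {suc m} {suc n} (s≤s n≤m) = ≤⇒<ᵇ-false n≤m

<ᵇ-suc : ∀ {a} t → a ≤ suc t → (a <ᵇ suc t) ≡ not (suc t ≡ᵇ a)
<ᵇ-suc {zero}  t       _           = refl
<ᵇ-suc {suc a} zero    (s≤s z≤n)   = refl
<ᵇ-suc {suc a} (suc t) (s≤s a≤suc-t) = <ᵇ-suc t a≤suc-t

length-filterᵇ-∷ : ∀ {A : Set} (p : A → Bool) x xs →
  length (filterᵇ p (x ∷ xs)) ≡ 𝟙 (p x) + length (filterᵇ p xs)
length-filterᵇ-∷ p x xs with p x
... | true  = refl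
... | false = refl

mult-++ : ∀ v xs ys → mult v (xs ++ ys) ≡ mult v xs + mult v ys
mult-++ v xs ys = trans (cong length (filter-++ (λ x → T? (x ≡ᵇ v)) xs ys))
                        (length-++ (filterᵇ (λ x → x ≡ᵇ v) xs))

mult-upTo-suc : ∀ v (f : ℕ → ℕ) m → mult v (map f (upTo (suc m))) ≡ mult v (map f (upTo m)) + 𝟙 (f m ≡ᵇ v)
mult-upTo-suc v f m = begin
  mult v (map f (upTo (suc m)))              ≡⟨ cong (mult v ∘ map f) (sym (upTo-∷ʳ m)) ⟩
  mult v (map f (upTo m ++ m ∷ []))          ≡⟨ cong (mult v) (map-++ f (upTo m) (m ∷ [])) ⟩
  mult v (map f (upTo m) ++ f m ∷ [])        ≡⟨ mult-++ v (map f (upTo m)) (f m ∷ []) ⟩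
  mult v (map f (upTo m)) + mult v (f m ∷ []) ≡⟨ cong (mult v (map f (upTo m)) +_) (length-filterᵇ-∷ (_≡ᵇ v) (f m) []) ⟩
  mult v (map f (upTo m)) + (𝟙 (f m ≡ᵇ v) + 0) ≡⟨ cong (mult v (map f (upTo m)) +_) (+-identityʳ _) ⟩
  mult v (map f (upTo m)) + 𝟙 (f m ≡ᵇ v)     ∎

mult-self : ∀ r xs → mult r (r ∷ xs) ≡ suc (mult r xs)
mult-self r xs = cong length (filter-accept (λ x → T? (x ≡ᵇ r)) {r} {xs} (≡⇒≡ᵇ r r refl))

mult-other : ∀ r {j} xs → ¬ T (r ≡ᵇ j) → mult j (r ∷ xs) ≡ mult j xs
mult-other r {j} xs r≢j = cong length (filter-reject (λ x → T? (x ≡ᵇ j)) {r} {xs} r≢j)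

mult-absent : ∀ v {xs} → All (_< v) xs → mult v xs ≡ 0
mult-absent v xs<v = cong length (filter-none (λ x → T? (x ≡ᵇ v))
  (All.map (λ {x} x<v x≡v → <-irrefl (≡ᵇ⇒≡ x v x≡v) x<v) xs<v))

-- Below a row of length r lie the rows rs; the cell in column j of
-- that row has arm r - j - 1 and leg 'longerThan j rs', the number of lower rows reaching
-- past column j.
longerThan : ℕ → List ℕ → ℕ
longerThan t rs = length (filterᵇ (t <ᵇ_) rs)

rowHook : ℕ → List ℕ → ℕ → ℕ
rowHook r rs j = (r ∸ suc j) + longerThan j rs + 1

hooks-∷ : ∀ r rs → hooks (r ∷ rs) ≡ map (rowHook r rs) (upTo r) ++ hooks rs
hooks-∷ r rs = refl

longerThan-∷ : ∀ {t y} ys → t < y → longerThan t (y ∷ ys) ≡ suc (longerThan t ys)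
longerThan-∷ {t} {y} ys t<y = cong length (filter-accept (T? ∘ (t <ᵇ_)) {y} {ys} (<⇒<ᵇ t<y))

longerThan-none : ∀ {t} rs → All (_≤ t) rs → longerThan t rs ≡ 0
longerThan-none {t} rs rs≤t = cong length (filter-none (T? ∘ (t <ᵇ_))
  (All.map (λ {y} y≤t t<y → ≤⇒≯ y≤t (<ᵇ⇒< t y t<y)) rs≤t))

noneLonger : ∀ t {rs} → IsPartition rs → (longerThan t rs ≡ᵇ 0) ≡ (head₀ rs <ᵇ suc t)
noneLonger t []                   = refl
noneLonger t {y ∷ ys} isP with y ≤? t
... | yes y≤t = trans (cong (_≡ᵇ 0) (longerThan-none (y ∷ ys) (All.map (λ z≤y → ≤-trans z≤y y≤t) (parts≤head isP))))
                      (sym (<⇒<ᵇ-true (s≤s y≤t)))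
... | no  y≰t = trans (cong (_≡ᵇ 0) (longerThan-∷ ys (≰⇒> y≰t))) (sym (≤⇒<ᵇ-false (≰⇒> y≰t)))

verticalEnd : ℕ → ℕ → ℕ → ℕ
verticalEnd a b c = 𝟙 ((a ≡ᵇ b) ∧ not (b ≡ᵇ c))

second₀ : List ℕ → ℕ
second₀ xs = head₀ (drop 1 xs)

oneLonger : ∀ t {rs} → IsPartition rs → head₀ rs ≤ suc t →
  𝟙 (longerThan t rs ≡ᵇ 1) ≡ verticalEnd (suc t) (head₀ rs) (second₀ rs)
oneLonger t []                        _   = refl
oneLonger t {y ∷ ys} isP@(cons _ ys≤y isP′) y≤ with y ≤? t
... | yes y≤t = begin
  𝟙 (longerThan t (y ∷ ys) ≡ᵇ 1) ≡⟨ cong (λ n → 𝟙 (n ≡ᵇ 1)) (longerThan-none (y ∷ ys) (All.map (λ z≤y → ≤-trans z≤y y≤t) (parts≤head isP))) ⟩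
  0                              ≡⟨ cong (λ b → 𝟙 (b ∧ not (y ≡ᵇ head₀ ys))) (sym (<⇒≡ᵇ-false (s≤s y≤t))) ⟩
  verticalEnd (suc t) y (head₀ ys) ∎
... | no  y≰t with refl ← ≤-antisym y≤ (≰⇒> y≰t) = begin
  𝟙 (longerThan t (suc t ∷ ys) ≡ᵇ 1)        ≡⟨ cong (λ n → 𝟙 (n ≡ᵇ 1)) (longerThan-∷ ys ≤-refl) ⟩
  𝟙 (longerThan t ys ≡ᵇ 0)                  ≡⟨ cong 𝟙 (noneLonger t isP′) ⟩
  𝟙 (head₀ ys <ᵇ suc t)                     ≡⟨ cong 𝟙 (<ᵇ-suc t ys≤y) ⟩
  𝟙 (not (suc t ≡ᵇ head₀ ys))               ≡⟨ cong (λ b → 𝟙 (b ∧ not (suc t ≡ᵇ head₀ ys))) (sym (≡ᵇ-refl t)) ⟩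
  verticalEnd (suc t) (suc t) (head₀ ys)    ∎

rowHook-> : ∀ v r rs j → v + j < r → v < rowHook r rs j
rowHook-> v r rs j v+j<r = ≤-<-trans (≤-trans v≤arm (m≤m+n (r ∸ suc j) (longerThan j rs)))
                                     (m<m+n _ (s≤s z≤n))
  where
  v≤arm : v ≤ r ∸ suc j
  v≤arm = m+n≤o⇒m≤o∸n v (subst (_≤ r) (sym (+-suc v j)) v+j<r)

row-noHook : ∀ v r rs m → (∀ {j} → j < m → v + j < r) → mult v (map (rowHook r rs) (upTo m)) ≡ 0
row-noHook v r rs zero    _     = refl
row-noHook v r rs (suc m) short = begin
  mult v (map (rowHook r rs) (upTo (suc m)))                   ≡⟨ mult-upTo-suc v (rowHook r rs) m ⟩
  mult v (map (rowHook r rs) (upTo m)) + 𝟙 (rowHook r rs m ≡ᵇ v) ≡⟨ cong₂ _+_ (row-noHook v r rs m (short ∘ m<n⇒m<1+n))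
                                                                          (cong 𝟙 (<⇒≡ᵇ-false (rowHook-> v r rs m (short ≤-refl)))) ⟩
  0                                                            ∎

rowHook-last : ∀ k rs → rowHook (suc k) rs k ≡ suc (longerThan k rs)
rowHook-last k rs = trans (cong (λ a → a + longerThan k rs + 1) (n∸n≡0 k)) (+-comm (longerThan k rs) 1)

rowHook-penultimate : ∀ k rs → rowHook (suc (suc k)) rs k ≡ suc (suc (longerThan k rs))
rowHook-penultimate k rs =
  trans (cong (λ a → a + longerThan k rs + 1) (m+n∸n≡m 1 k)) (cong suc (+-comm (longerThan k rs) 1))

row-count₁ : ∀ k {rs} → IsPartition rs → mult 1 (map (rowHook (suc k) rs) (upTo (suc k))) ≡ 𝟙 (head₀ rs <ᵇ suc k)
row-count₁ k {rs} isP = begin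
  mult 1 (map (rowHook (suc k) rs) (upTo (suc k)))                       ≡⟨ mult-upTo-suc 1 (rowHook (suc k) rs) k ⟩
  mult 1 (map (rowHook (suc k) rs) (upTo k)) + 𝟙 (rowHook (suc k) rs k ≡ᵇ 1) ≡⟨ cong₂ _+_ (row-noHook 1 (suc k) rs k s≤s)
                                                                                (cong (λ h → 𝟙 (h ≡ᵇ 1)) (rowHook-last k rs)) ⟩
  𝟙 (longerThan k rs ≡ᵇ 0)                                               ≡⟨ cong 𝟙 (noneLonger k isP) ⟩
  𝟙 (head₀ rs <ᵇ suc k)                                                  ∎

row-count₂-horizontal : ∀ k {rs} → IsPartition rs →
  mult 2 (map (rowHook (suc k) rs) (upTo k)) ≡ 𝟙 (suc (head₀ rs) <ᵇ suc k)
row-count₂-horizontal zero    isP = refl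
row-count₂-horizontal (suc k) {rs} isP = begin
  mult 2 (map f (upTo (suc k)))             ≡⟨ mult-upTo-suc 2 f k ⟩
  mult 2 (map f (upTo k)) + 𝟙 (f k ≡ᵇ 2)   ≡⟨ cong₂ _+_ (row-noHook 2 (suc (suc k)) rs k (s≤s ∘ s≤s))
                                                       (cong (λ h → 𝟙 (h ≡ᵇ 2)) (rowHook-penultimate k rs)) ⟩
  𝟙 (longerThan k rs ≡ᵇ 0)                  ≡⟨ cong 𝟙 (noneLonger k isP) ⟩
  𝟙 (head₀ rs <ᵇ suc k)                     ∎
  where f = rowHook (suc (suc k)) rs

row-count₂ : ∀ k {rs} → IsPartition rs → head₀ rs ≤ suc k →
  mult 2 (map (rowHook (suc k) rs) (upTo (suc k))) ≡ 𝟙 (suc (head₀ rs) <ᵇ suc k) + verticalEnd (suc k) (head₀ rs) (second₀ rs)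
row-count₂ k {rs} isP rs≤ = begin
  mult 2 (map (rowHook (suc k) rs) (upTo (suc k)))                        ≡⟨ mult-upTo-suc 2 (rowHook (suc k) rs) k ⟩
  mult 2 (map (rowHook (suc k) rs) (upTo k)) + 𝟙 (rowHook (suc k) rs k ≡ᵇ 2) ≡⟨ cong₂ _+_ (row-count₂-horizontal k isP)
                                                                                (cong (λ h → 𝟙 (h ≡ᵇ 2)) (rowHook-last k rs)) ⟩
  𝟙 (suc (head₀ rs) <ᵇ suc k) + 𝟙 (longerThan k rs ≡ᵇ 1)                 ≡⟨ cong (𝟙 (suc (head₀ rs) <ᵇ suc k) +_) (oneLonger k isP rs≤) ⟩
  𝟙 (suc (head₀ rs) <ᵇ suc k) + verticalEnd (suc k) (head₀ rs) (second₀ rs) ∎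

-- Statistics of a partition read off consecutive rows:
-- corners    = #{i : rᵢ > rᵢ₊₁}               (cells of hook length 1),
-- horizontal = #{i : rᵢ ≥ rᵢ₊₁ + 2}            (hook 2 with arm 1),
-- vertical   = #{i : rᵢ = rᵢ₊₁ ≠ rᵢ₊₂}        (hook 2 with leg 1).
corners : List ℕ → ℕ
corners []       = 0
corners (r ∷ rs) = 𝟙 (head₀ rs <ᵇ r) + corners rs

horizontal : List ℕ → ℕ
horizontal []       = 0
horizontal (r ∷ rs) = 𝟙 (suc (head₀ rs) <ᵇ r) + horizontal rs

vertical : List ℕ → ℕ
vertical []       = 0
vertical (r ∷ rs) = verticalEnd r (head₀ rs) (second₀ rs) + vertical rs

hooks-count₁ : ∀ {xs} → IsPartition xs → mult 1 (hooks xs) ≡ corners xs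
hooks-count₁ []                               = refl
hooks-count₁ {suc k ∷ rs} (cons _ _ isP) = begin
  mult 1 (hooks (suc k ∷ rs))                                       ≡⟨ cong (mult 1) (hooks-∷ (suc k) rs) ⟩
  mult 1 (map (rowHook (suc k) rs) (upTo (suc k)) ++ hooks rs)        ≡⟨ mult-++ 1 (map (rowHook (suc k) rs) (upTo (suc k))) (hooks rs) ⟩
  mult 1 (map (rowHook (suc k) rs) (upTo (suc k))) + mult 1 (hooks rs) ≡⟨ cong₂ _+_ (row-count₁ k isP) (hooks-count₁ isP) ⟩
  corners (suc k ∷ rs)                                                ∎

hooks-count₂ : ∀ {xs} → IsPartition xs → mult 2 (hooks xs) ≡ horizontal xs + vertical xs
hooks-count₂ []                               = refl
hooks-count₂ {suc k ∷ rs} (cons _ rs≤ isP) = begin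
  mult 2 (hooks (suc k ∷ rs))                                       ≡⟨ cong (mult 2) (hooks-∷ (suc k) rs) ⟩
  mult 2 (map (rowHook (suc k) rs) (upTo (suc k)) ++ hooks rs)        ≡⟨ mult-++ 2 (map (rowHook (suc k) rs) (upTo (suc k))) (hooks rs) ⟩
  mult 2 (map (rowHook (suc k) rs) (upTo (suc k))) + mult 2 (hooks rs) ≡⟨ cong₂ _+_ (row-count₂ k isP rs≤) (hooks-count₂ isP) ⟩
  (h + v) + (horizontal rs + vertical rs)                             ≡⟨ ℕ-interchange h v (horizontal rs) (vertical rs) ⟩
  (h + horizontal rs) + (v + vertical rs)                             ∎
  where
  h = 𝟙 (suc (head₀ rs) <ᵇ suc k)
  v = verticalEnd (suc k) (head₀ rs) (second₀ rs)

data FirstPart (r : ℕ) : List ℕ → Set where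
  largest  : ∀ {rs} → head₀ rs < r → All (_< r) rs → FirstPart r rs
  repeated : ∀ {ys} → FirstPart r (r ∷ ys)

firstPart : ∀ {r rs} → IsPartition (r ∷ rs) → FirstPart r rs
firstPart {rs = []}     (cons 1≤r _ _) = largest 1≤r []
firstPart {rs = y ∷ ys} (cons _ y≤r isP) with m≤n⇒m<n∨m≡n y≤r
... | inj₁ y<r  = largest y<r (All.map (λ z≤y → ≤-<-trans z≤y y<r) (parts≤head isP))
... | inj₂ refl = repeated

distinct-below : ∀ r {rs} → All (_< r) rs → All (λ j → ¬ T (r ≡ᵇ j)) (distinctParts rs)
distinct-below r rs<r = AllP.deduplicate⁺ _ (All.map (λ {y} y<r r≡y → <-irrefl (sym (≡ᵇ⇒≡ r y r≡y)) y<r) rs<r)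

distinct-largest : ∀ r {rs} → All (_< r) rs → distinctParts (r ∷ rs) ≡ r ∷ distinctParts rs
distinct-largest r rs<r = cong (r ∷_) (filter-all (λ y → ¬? (T? (r ≡ᵇ y))) (distinct-below r rs<r))

distinct-repeated : ∀ r ys → distinctParts (r ∷ r ∷ ys) ≡ distinctParts (r ∷ ys)
distinct-repeated r ys = cong (r ∷_) (trans
  (filter-reject (λ y → ¬? (T? (r ≡ᵇ y))) (λ r≢r → r≢r (≡⇒≡ᵇ r r refl)))
  (filter-idem (λ y → ¬? (T? (r ≡ᵇ y))) (distinctParts ys)))

ℓ₀-corners : ∀ {xs} → IsPartition xs → ℓ₀ xs ≡ corners xs
ℓ₀-corners []                         = refl
ℓ₀-corners {r ∷ rs} isP@(cons _ _ isP′) with firstPart isP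
... | largest rs<r all<r = begin
  length (distinctParts (r ∷ rs)) ≡⟨ cong length (distinct-largest r all<r) ⟩
  suc (ℓ₀ rs)                     ≡⟨ cong₂ _+_ (cong 𝟙 (sym (<⇒<ᵇ-true rs<r))) (ℓ₀-corners isP′) ⟩
  corners (r ∷ rs)                ∎
... | repeated {ys} = begin
  length (distinctParts (r ∷ r ∷ ys)) ≡⟨ cong length (distinct-repeated r ys) ⟩
  ℓ₀ (r ∷ ys)                         ≡⟨ cong₂ _+_ (cong 𝟙 (sym (≤⇒<ᵇ-false (≤-refl {r})))) (ℓ₀-corners isP′) ⟩
  corners (r ∷ r ∷ ys)                ∎

repeatedAmong : List ℕ → List ℕ → ℕ
repeatedAmong xs ds = length (filterᵇ (λ j → 2 ≤ᵇ mult j xs) ds)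

repeatedAmong-other : ∀ r xs {ds} → All (λ j → ¬ T (r ≡ᵇ j)) ds → repeatedAmong (r ∷ xs) ds ≡ repeatedAmong xs ds
repeatedAmong-other r xs {[]}     []              = refl
repeatedAmong-other r xs {d ∷ ds} (r≢d ∷ r≢ds) = begin
  repeatedAmong (r ∷ xs) (d ∷ ds)                      ≡⟨ length-filterᵇ-∷ (λ j → 2 ≤ᵇ mult j (r ∷ xs)) d ds ⟩
  𝟙 (2 ≤ᵇ mult d (r ∷ xs)) + repeatedAmong (r ∷ xs) ds ≡⟨ cong₂ (λ m n → 𝟙 (2 ≤ᵇ m) + n) (mult-other r xs r≢d)
                                                                 (repeatedAmong-other r xs r≢ds) ⟩
  𝟙 (2 ≤ᵇ mult d xs) + repeatedAmong xs ds             ≡⟨ sym (length-filterᵇ-∷ (λ j → 2 ≤ᵇ mult j xs) d ds) ⟩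
  repeatedAmong xs (d ∷ ds)                            ∎

repeatedSizes-largest : ∀ r {rs} → All (_< r) rs → repeatedSizes (r ∷ rs) ≡ repeatedSizes rs
repeatedSizes-largest r {rs} rs<r = begin
  repeatedAmong (r ∷ rs) (distinctParts (r ∷ rs))                  ≡⟨ cong (repeatedAmong (r ∷ rs)) (distinct-largest r rs<r) ⟩
  repeatedAmong (r ∷ rs) (r ∷ distinctParts rs)                    ≡⟨ length-filterᵇ-∷ (λ j → 2 ≤ᵇ mult j (r ∷ rs)) r (distinctParts rs) ⟩
  𝟙 (2 ≤ᵇ mult r (r ∷ rs)) + repeatedAmong (r ∷ rs) (distinctParts rs) ≡⟨ cong₂ (λ m n → 𝟙 (2 ≤ᵇ m) + n)
                                                                         (trans (mult-self r rs) (cong suc (mult-absent r rs<r)))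
                                                                         (repeatedAmong-other r rs (distinct-below r rs<r)) ⟩
  repeatedSizes rs                                                 ∎

𝟙-not : ∀ c n → 𝟙 (not c) + (𝟙 c + n) ≡ suc n
𝟙-not true  n = refl
𝟙-not false n = refl

repeatedSizes-repeated : ∀ r ys →
  repeatedSizes (r ∷ r ∷ ys) ≡ 𝟙 (not (2 ≤ᵇ mult r (r ∷ ys))) + repeatedSizes (r ∷ ys)
repeatedSizes-repeated r ys = begin
  repeatedAmong (r ∷ r ∷ ys) (distinctParts (r ∷ r ∷ ys)) ≡⟨ cong (repeatedAmong (r ∷ r ∷ ys)) (distinct-repeated r ys) ⟩
  repeatedAmong (r ∷ r ∷ ys) (r ∷ E)                      ≡⟨ length-filterᵇ-∷ (λ j → 2 ≤ᵇ mult j (r ∷ r ∷ ys)) r E ⟩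
  𝟙 (2 ≤ᵇ mult r (r ∷ r ∷ ys)) + repeatedAmong (r ∷ r ∷ ys) E ≡⟨ cong₂ (λ m n → 𝟙 (2 ≤ᵇ m) + n) (trans (mult-self r (r ∷ ys)) (cong suc (mult-self r ys)))
                                                                 (repeatedAmong-other r (r ∷ ys) (AllP.all-filter (λ y → ¬? (T? (r ≡ᵇ y))) (distinctParts ys))) ⟩
  suc (repeatedAmong (r ∷ ys) E)                          ≡⟨ sym (𝟙-not (2 ≤ᵇ mult r (r ∷ ys)) _) ⟩
  𝟙 (not (2 ≤ᵇ mult r (r ∷ ys))) + (𝟙 (2 ≤ᵇ mult r (r ∷ ys)) + repeatedAmong (r ∷ ys) E)
                                                          ≡⟨ cong (𝟙 (not (2 ≤ᵇ mult r (r ∷ ys))) +_)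
                                                               (sym (length-filterᵇ-∷ (λ j → 2 ≤ᵇ mult j (r ∷ ys)) r E)) ⟩
  𝟙 (not (2 ≤ᵇ mult r (r ∷ ys))) + repeatedSizes (r ∷ ys) ∎
  where E = filter (λ y → ¬? (T? (r ≡ᵇ y))) (distinctParts ys)

first-repeated : ∀ {r ys} → IsPartition (r ∷ ys) → (2 ≤ᵇ mult r (r ∷ ys)) ≡ (r ≡ᵇ head₀ ys)
first-repeated {r} {ys} isP with firstPart isP
... | largest ys<r all<r = begin
  2 ≤ᵇ mult r (r ∷ ys) ≡⟨ cong (2 ≤ᵇ_) (trans (mult-self r ys) (cong suc (mult-absent r all<r))) ⟩
  false                ≡⟨ sym (<⇒≡ᵇ-false ys<r) ⟩
  r ≡ᵇ head₀ ys        ∎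
... | repeated {zs} = begin
  2 ≤ᵇ mult r (r ∷ r ∷ zs) ≡⟨ cong (2 ≤ᵇ_) (trans (mult-self r (r ∷ zs)) (cong suc (mult-self r zs))) ⟩
  true                     ≡⟨ sym (≡ᵇ-refl r) ⟩
  r ≡ᵇ r                   ∎

repeatedSizes-vertical : ∀ {xs} → IsPartition xs → repeatedSizes xs ≡ vertical xs
repeatedSizes-vertical []                         = refl
repeatedSizes-vertical {r ∷ rs} isP@(cons _ _ isP′) with firstPart isP
... | largest rs<r all<r = begin
  repeatedSizes (r ∷ rs)                            ≡⟨ repeatedSizes-largest r all<r ⟩
  repeatedSizes rs                                  ≡⟨ repeatedSizes-vertical isP′ ⟩
  vertical rs                                       ≡⟨ cong (λ b → 𝟙 (b ∧ not (head₀ rs ≡ᵇ second₀ rs)) + vertical rs)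
                                                         (sym (<⇒≡ᵇ-false rs<r)) ⟩
  vertical (r ∷ rs)                                 ∎
... | repeated {ys} = begin
  repeatedSizes (r ∷ r ∷ ys)                        ≡⟨ repeatedSizes-repeated r ys ⟩
  𝟙 (not (2 ≤ᵇ mult r (r ∷ ys))) + repeatedSizes (r ∷ ys) ≡⟨ cong₂ (λ b n → 𝟙 (not b) + n) (first-repeated isP′)
                                                                  (repeatedSizes-vertical isP′) ⟩
  𝟙 (not (r ≡ᵇ head₀ ys)) + vertical (r ∷ ys)       ≡⟨ cong (λ b → 𝟙 (b ∧ not (r ≡ᵇ head₀ ys)) + vertical (r ∷ ys))
                                                         (sym (≡ᵇ-refl r)) ⟩
  vertical (r ∷ r ∷ ys)                             ∎

-- Conjugation turns horizontal 2-hooks into vertical ones.  Adding a column of height r to a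
-- partition with fewer than r - 1 rows creates one new vertical 2-hook (at the bottom of the
-- column) and leaves the others in place.
vertical-column : ∀ r → vertical (addColumn r []) ≡ 𝟙 (1 <ᵇ r)
vertical-column zero                = refl
vertical-column (suc zero)          = refl
vertical-column (suc (suc zero))    = refl
vertical-column (suc (suc (suc r))) = vertical-column (suc (suc r))

verticalEnd-addColumn : ∀ x r {xs} → 1 ≤ x → IsPartition xs → length xs ≤ r →
  verticalEnd (suc x) (head₀ (addColumn r xs)) (second₀ (addColumn r xs)) ≡ verticalEnd x (head₀ xs) (second₀ xs)
verticalEnd-addColumn (suc x) zero          {[]}         _ _ _ = refl
verticalEnd-addColumn (suc x) (suc r)       {[]}         _ _ _ = refl
verticalEnd-addColumn x       (suc zero)    {suc y ∷ []} _ _ _ = refl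
verticalEnd-addColumn x       (suc (suc r)) {suc y ∷ []} _ _ _ = refl
verticalEnd-addColumn x       (suc r)       {zero ∷ []}  _ (cons () _ _) _
verticalEnd-addColumn x       (suc (suc r)) {y ∷ z ∷ xs} _ _ _ = refl
verticalEnd-addColumn x       (suc zero)    {y ∷ z ∷ xs} _ _ (s≤s ())

vertical-addColumn : ∀ r {xs} → IsPartition xs → length xs ≤ r →
  vertical (addColumn r xs) ≡ 𝟙 (suc (length xs) <ᵇ r) + vertical xs
vertical-addColumn r       {[]}     _                  _         = trans (vertical-column r) (sym (+-identityʳ _))
vertical-addColumn (suc r) {x ∷ xs} (cons 1≤x _ isP′) (s≤s len) = begin
  verticalEnd (suc x) (head₀ (addColumn r xs)) (second₀ (addColumn r xs)) + vertical (addColumn r xs)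
    ≡⟨ cong₂ _+_ (verticalEnd-addColumn x r 1≤x isP′ len) (vertical-addColumn r isP′ len) ⟩
  verticalEnd x (head₀ xs) (second₀ xs) + (𝟙 (suc (length xs) <ᵇ r) + vertical xs)
    ≡⟨ x∙yz≈y∙xz (verticalEnd x (head₀ xs) (second₀ xs)) (𝟙 (suc (length xs) <ᵇ r)) (vertical xs) ⟩
  𝟙 (suc (length xs) <ᵇ r) + vertical (x ∷ xs)
    ∎

horizontal-conj : ∀ {xs} → IsPartition xs → horizontal xs ≡ vertical (conj xs)
horizontal-conj []                        = refl
horizontal-conj {r ∷ rs} (cons _ rs≤r isP) = begin
  𝟙 (suc (head₀ rs) <ᵇ r) + horizontal rs                  ≡⟨ cong₂ (λ n m → 𝟙 (suc n <ᵇ r) + m) (sym (conj-length isP)) (horizontal-conj isP) ⟩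
  𝟙 (suc (length (conj rs)) <ᵇ r) + vertical (conj rs)     ≡⟨ sym (vertical-addColumn r (conj-partition isP) (conj-fits isP rs≤r)) ⟩
  vertical (addColumn r (conj rs))                         ∎

sum-partitions-cong : ∀ n (f g : List ℕ → ℕ) → (∀ {xs} → IsPartition xs → f xs ≡ g xs) →
  sum (map f (partitions n)) ≡ sum (map g (partitions n))
sum-partitions-cong n f g f≡g = cong sum (map-cong-local (All.tabulate (f≡g ∘ proj₁ ∘ partitions-sound n)))

sum-map-+ : ∀ {A : Set} (f g : A → ℕ) xs → sum (map (λ x → f x + g x) xs) ≡ sum (map f xs) + sum (map g xs)
sum-map-+ f g []       = refl
sum-map-+ f g (x ∷ xs) =
  trans (cong (f x + g x +_) (sum-map-+ f g xs)) (ℕ-interchange (f x) (g x) (sum (map f xs)) (sum (map g xs)))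

total-hooks₁ : ∀ n → sum (map (mult 1 ∘ hooks) (partitions n)) ≡ sum (map ℓ₀ (partitions n))
total-hooks₁ n = sum-partitions-cong n (mult 1 ∘ hooks) ℓ₀ (λ isP → trans (hooks-count₁ isP) (sym (ℓ₀-corners isP)))

-- ... and hooks of length 2 total twice the repeated sizes, since conjugation matches the
-- horizontal 2-hooks with the vertical ones, which correspond to repeated sizes.
total-hooks₂ : ∀ n → sum (map (mult 2 ∘ hooks) (partitions n)) ≡
                     sum (map repeatedSizes (partitions n)) + sum (map repeatedSizes (partitions n))
total-hooks₂ n = begin
  sum (map (mult 2 ∘ hooks) L)                              ≡⟨ sum-partitions-cong n (mult 2 ∘ hooks) (λ xs → horizontal xs + vertical xs) hooks-count₂ ⟩
  sum (map (λ xs → horizontal xs + vertical xs) L)          ≡⟨ sum-map-+ horizontal vertical L ⟩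
  sum (map horizontal L) + sum (map vertical L)             ≡⟨ cong (_+ sum (map vertical L)) (sum-partitions-cong n horizontal (vertical ∘ conj) horizontal-conj) ⟩
  sum (map (vertical ∘ conj) L) + sum (map vertical L)      ≡⟨ cong (_+ sum (map vertical L)) (sum-conj-invariant vertical n) ⟩
  sum (map vertical L) + sum (map vertical L)               ≡⟨ cong (λ s → s + s) (sym (sum-partitions-cong n repeatedSizes vertical repeatedSizes-vertical)) ⟩
  sum (map repeatedSizes L) + sum (map repeatedSizes L)     ∎
  where L = partitions n

mainTheorem10 : (n : ℕ) →
    (coeff (hookPoly n) 0 ≡ coeff (freqPoly n) 0) × (coeff (hookPoly n) 1 ≡ coeff (freqPoly n) 1)
mainTheorem10 n = constantTerms , linearTerms
  where
  L = partitions n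
  R = sum (map repeatedSizes L)

  constantTerms : coeff (hookPoly n) 0 ≡ coeff (freqPoly n) 0
  constantTerms = trans (polySum-coeff₀ hookTerm hookTerm-coeff₀ L) (sym (polySum-coeff₀ freqTerm freqTerm-coeff₀ L))

  linearTerms : coeff (hookPoly n) 1 ≡ coeff (freqPoly n) 1
  linearTerms = begin
    coeff (hookPoly n) 1
      ≡⟨ polySum-coeff₁ hookTerm (mult 1 ∘ hooks) (mult 2 ∘ hooks) 1ℚ ¼ hookTerm-coeff₁ L ⟩
    ℚ.- (sum (map (mult 1 ∘ hooks) L) · 1ℚ ℚ.+ sum (map (mult 2 ∘ hooks) L) · ¼)
      ≡⟨ cong₂ (λ a b → ℚ.- (a · 1ℚ ℚ.+ b · ¼)) (total-hooks₁ n) (total-hooks₂ n) ⟩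
    ℚ.- (sum (map ℓ₀ L) · 1ℚ ℚ.+ (R + R) · ¼)
      ≡⟨ cong (λ q → ℚ.- (sum (map ℓ₀ L) · 1ℚ ℚ.+ q)) (double-quarter R) ⟩
    ℚ.- (sum (map ℓ₀ L) · 1ℚ ℚ.+ R · ½)
      ≡⟨ sym (polySum-coeff₁ freqTerm ℓ₀ repeatedSizes 1ℚ ½ freqTerm-coeff₁ L) ⟩
    coeff (freqPoly n) 1
      ∎
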